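{- Let $A=(a_0,\dots,a_{n-1})$ be an integer array with $|a_m-a_{m+1}|=1$ for all $0\le m<n-1$. Let $b\ge 1$ be an integer and let $M$ be a power of two with $(M-1)b<n$. Let $i$ be an integer with $0\le i\le M-1$, and let $x$ be an integer with $a_0-n<x$ and $x<a_{ib}-2b$. Set $d=\lfloor (a_{ib}-x)/b\rfloor$ and suppose that $d>f(i)$. Let $l=i-d+1$ and $k=\mathrm{LCA}_{BT}(l,i)$. Then $a_{kb}-x\le f(k)\cdot b$.
   Context: Define $f(0)=n$ and, for $m>0$, $f(m)=3\cdot 2^{\rho(m)}$. Here $\rho(m)$ is the position of the rightmost nonzero bit in the binary representation of $m$, counting from $0$. $\mathrm{LCA}_{BT}(p,q)$ denotes the lowest common ancestor of nodes $p$ and $q$ in the complete balanced binary tree with $M-1$ nodes numbered $1,\dots,M-1$ in symmetric (in-order) order. By convention, $\mathrm{LCA}_{BT}(p,q)=0$ when $p\le 0<q$. In the paper's algorithm, $b=\lfloor(\log n)/2\rfloor$ is the block length, and $k$ is a block index, with $kb$ the first position of that block. -}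

module Defs where

open import Data.Nat as ℕ using (ℕ; zero; suc; _^_; _∸_; _+_; _*_)
open import Data.Nat.DivMod using (_/_; _%_)
open import Data.Integer as ℤ using (ℤ; +_)
open import Data.Bool using (Bool; true; false; if_then_else_)
open import Relation.Nullary.Decidable using (⌊_⌋)

-- ρ(m): position of the rightmost nonzero bit of m (counting from 0), for m > 0.
-- Computed by repeatedly halving while even; the first argument is fuel
-- (fuel m suffices since m ≥ 2^ρ(m) > ρ(m)).
rhoAux : ℕ → ℕ → ℕ
rhoAux zero    m = zero
rhoAux (suc f) zero = zero
rhoAux (suc f) (suc m) with suc m % 2
... | zero  = suc (rhoAux f (suc m / 2))
... | suc _ = zero

rho : ℕ → ℕ
rho m = rhoAux m m

fF : ℕ → ℕ → ℕ
fF n zero    = n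
fF n (suc m) = 3 * 2 ^ rho (suc m)

-- Descend the complete balanced binary tree (in-order numbering).
-- lcaAux j c p q : we are at node c, whose children (if j ≥ 1) are c ∓ 2^(j-1);
-- go left if q < c, right if c < p, otherwise c is the LCA.
lcaAux : ℕ → ℕ → ℤ → ℤ → ℕ
lcaAux zero    c p q = c
lcaAux (suc j) c p q =
  if ⌊ q ℤ.<? + c ⌋ then lcaAux j (c ∸ 2 ^ j) p q
  else if ⌊ + c ℤ.<? p ⌋ then lcaAux j (c + 2 ^ j) p q
  else c

-- LCA_BT(p,q) in the complete balanced binary tree with M - 1 nodes,
-- M = 2^e, nodes 1..M-1 numbered in symmetric order (root M/2 = 2^(e-1)).
-- Convention: LCA_BT(p,q) = 0 when p ≤ 0 < q.
lcaBT : ℕ → ℤ → ℤ → ℕ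
lcaBT zero    p q = zero
lcaBT (suc e) p q =
  if ⌊ p ℤ.≤? + 0 ⌋ Data.Bool.∧ ⌊ + 0 ℤ.<? q ⌋ then zero
  else lcaAux e (2 ^ e) p q

-- Node 2^j·(2t+1) of the tree has height j, f-value 3·2^j, and subtree (k - 2^j, k + 2^j).
-- The LCA k of l and i therefore satisfies l ≤ k ≤ i, i - k < 2^j and d = i - l + 1 ≤ (i - k) + 2^j.
-- As A moves by at most one per step, a_{kb} - x ≤ (a_{ib} - x) + (i - k)b < (d + 1 + (i - k))b,
-- and d + 1 + (i - k) ≤ 2^j + 2(i - k) + 1 ≤ 3·2^j.  When l ≤ 0 the LCA is the virtual node 0
-- with f(0) = n, and a_0 - x < n already; i = 0 is impossible, as then d ≤ a_0 - x < n = f(0).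
module Submission where

open import Defs
open import Data.Nat as ℕ using (ℕ; suc; _^_; _∸_; NonZero)
open import Data.Integer as ℤ using (ℤ; +_; _-_; _/ℕ_; ∣_∣; 1ℤ)
open import Relation.Binary.PropositionalEquality using (_≡_)

open import Data.Nat using (zero; _+_; _*_; _≤_; _<_; z≤n; s≤s; z<s)
open import Data.Integer using (0ℤ)
open import Data.Nat.Properties
open import Data.Nat.DivMod using (_%_; _/_; m≡m%n+[m/n]*n; m%n<n; [m+kn]%n≡m%n; m*n%n≡0; m*n/n≡m; m/n≤m)
open import Data.Nat.Tactic.RingSolver using (solve-∀)
import Data.Integer.Properties as ℤP
import Data.Integer.Tactic.RingSolver as ℤSolver
open import Data.Product using (_,_)
open import Relation.Nullary using (yes; no; contradiction)
open import Relation.Binary.PropositionalEquality using (refl; sym; trans; cong; subst; module ≡-Reasoning)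
open import Function using (_∘_)

n<2^n : ∀ n → n < 2 ^ n
n<2^n zero    = z<s
n<2^n (suc n) = +-mono-≤ (m^n>0 2 n) (subst (suc n ≤_) (sym (+-identityʳ (2 ^ n))) (n<2^n n))

rhoAux-odd : ∀ f m → suc m % 2 ≡ 1 → rhoAux (suc f) (suc m) ≡ 0
rhoAux-odd f m odd with suc m % 2
rhoAux-odd f m () | zero
... | suc _ = refl

rhoAux-even : ∀ f m → suc m % 2 ≡ 0 → rhoAux (suc f) (suc m) ≡ suc (rhoAux f (suc m / 2))
rhoAux-even f m even with suc m % 2
... | zero = refl
rhoAux-even f m () | suc _

2^j*odd>0 : ∀ j t → 0 < 2 ^ j * (1 + t * 2)
2^j*odd>0 j t = *-mono-≤ (m^n>0 2 j) (s≤s z≤n)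

rhoAux-2^j*odd : ∀ {f} j t m → m ≡ 2 ^ j * (1 + t * 2) → j < f → rhoAux f m ≡ j
rhoAux-2^j*odd j t zero m≡ _ = contradiction (subst (0 <_) (sym m≡) (2^j*odd>0 j t)) (<-irrefl refl)
rhoAux-2^j*odd {suc f} zero t (suc m) m≡ _ =
  rhoAux-odd f m (trans (cong (_% 2) (trans m≡ (*-identityˡ _))) ([m+kn]%n≡m%n 1 t 2))
rhoAux-2^j*odd {suc f} (suc j) t (suc m) m≡ (s≤s j<f) =
  trans (rhoAux-even f m (trans (cong (_% 2) m≡half*2) (m*n%n≡0 half 2)))
        (cong suc (rhoAux-2^j*odd j t (suc m / 2) (trans (cong (_/ 2) m≡half*2) (m*n/n≡m half 2)) j<f))
  where
  half : ℕ
  half = 2 ^ j * (1 + t * 2)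
  m≡half*2 : suc m ≡ half * 2
  m≡half*2 = trans m≡ (trans (*-assoc 2 (2 ^ j) (1 + t * 2)) (*-comm 2 half))

rho-2^j*odd : ∀ j t → rho (2 ^ j * (1 + t * 2)) ≡ j
rho-2^j*odd j t = rhoAux-2^j*odd j t _ refl (<-≤-trans (n<2^n j) (m≤m*n (2 ^ j) (1 + t * 2)))

fF-2^j*odd : ∀ n {k} j t → k ≡ 2 ^ j * (1 + t * 2) → fF n k ≡ 3 * 2 ^ j
fF-2^j*odd n {zero} j t k≡ = contradiction (subst (0 <_) (sym k≡) (2^j*odd>0 j t)) (<-irrefl refl)
fF-2^j*odd n {suc k} j t k≡ = cong (λ r → 3 * 2 ^ r) (trans (cong rho k≡) (rho-2^j*odd j t))

record LowestCommonAncestor (p q k : ℕ) : Set where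
  field
    height offset : ℕ
    node          : k ≡ 2 ^ height * (1 + offset * 2)
    p≤k           : p ≤ k
    k≤q           : k ≤ q
    k<p+2^height  : k < p + 2 ^ height
    q<k+2^height  : q < k + 2 ^ height

p+2P≡p+P+P : ∀ {P} p → p + 2 * P ≡ p + P + P
p+2P≡p+P+P {P} p = trans (cong (λ z → p + (P + z)) (+-identityʳ P)) (sym (+-assoc p P P))

lcaAux-lowestCommonAncestor : ∀ j c t {p q} → c ≡ 2 ^ j * (1 + t * 2) → p ≤ q
  → c < p + 2 ^ j → q < c + 2 ^ j → LowestCommonAncestor p q (lcaAux j c (+ p) (+ q))
lcaAux-lowestCommonAncestor zero c t {p} {q} c≡ p≤q c<p+1 q<c+1 =
  record { height = 0 ; offset = t ; node = c≡ ; p≤k = ≤-trans p≤q q≤c ; k≤q = ≤-trans c≤p p≤q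
         ; k<p+2^height = c<p+1 ; q<k+2^height = q<c+1 }
  where
  c≤p : c ≤ p
  c≤p = m<1+n⇒m≤n (subst (c <_) (+-comm _ 1) c<p+1)
  q≤c : q ≤ c
  q≤c = m<1+n⇒m≤n (subst (q <_) (+-comm _ 1) q<c+1)
lcaAux-lowestCommonAncestor (suc j) c t {p} {q} c≡ p≤q c<p+2P q<c+2P with + q ℤ.<? + c
... | yes q<c = lcaAux-lowestCommonAncestor j (c ∸ P) (t * 2) left≡ p≤q
  (+-cancelʳ-< P _ _ (subst (_< p + P + P) (sym left+P≡c) (subst (c <_) (p+2P≡p+P+P p) c<p+2P)))
  (subst (q <_) (sym left+P≡c) (ℤP.drop‿+<+ q<c))
  where
  P : ℕ
  P = 2 ^ j
  left-child : P * (1 + t * 2 * 2) + P ≡ c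
  left-child = trans (split P t) (sym c≡)
    where
    split : ∀ P t → P * (1 + t * 2 * 2) + P ≡ 2 * P * (1 + t * 2)
    split = solve-∀
  left≡ : c ∸ P ≡ P * (1 + t * 2 * 2)
  left≡ = trans (cong (_∸ P) (sym left-child)) (m+n∸n≡m _ P)
  left+P≡c : c ∸ P + P ≡ c
  left+P≡c = trans (cong (_+ P) left≡) left-child
... | no q≮c with + c ℤ.<? + p
... | yes c<p = lcaAux-lowestCommonAncestor j (c + P) (1 + t * 2) right≡ p≤q
  (+-monoˡ-< P (ℤP.drop‿+<+ c<p))
  (subst (q <_) (p+2P≡p+P+P c) q<c+2P)
  where
  P : ℕ
  P = 2 ^ j
  right≡ : c + P ≡ P * (1 + (1 + t * 2) * 2)
  right≡ = trans (cong (_+ P) c≡) (split P t)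
    where
    split : ∀ P t → 2 * P * (1 + t * 2) + P ≡ P * (1 + (1 + t * 2) * 2)
    split = solve-∀
... | no c≮p = record { height = suc j ; offset = t ; node = c≡
                      ; p≤k = ≮⇒≥ (c≮p ∘ ℤ.+<+) ; k≤q = ≮⇒≥ (q≮c ∘ ℤ.+<+)
                      ; k<p+2^height = c<p+2P ; q<k+2^height = q<c+2P }

lcaBT-lowestCommonAncestor : ∀ e {p q} → 0 < p → p ≤ q → q < 2 ^ e
  → LowestCommonAncestor p q (lcaBT e (+ p) (+ q))
lcaBT-lowestCommonAncestor zero 0<p p≤q (s≤s z≤n) = contradiction (≤-trans 0<p p≤q) λ ()
lcaBT-lowestCommonAncestor (suc e) {suc p} {q} _ p≤q q<2P =
  lcaAux-lowestCommonAncestor e P 0 (sym (*-identityʳ P)) p≤q (m<n+m P z<s)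
    (subst (q <_) (p+2P≡p+P+P {P} 0) q<2P)
  where
  P : ℕ
  P = 2 ^ e

lcaBT-nonpositive : ∀ e {p q} → p ℤ.≤ + 0 → + 0 ℤ.< q → lcaBT e p q ≡ 0
lcaBT-nonpositive zero _ _ = refl
lcaBT-nonpositive (suc e) {p} {q} p≤0 0<q with p ℤ.≤? + 0 | + 0 ℤ.<? q
... | yes _ | yes _   = refl
... | no p≰0 | _      = contradiction p≤0 p≰0
... | yes _ | no 0≮q = contradiction 0<q 0≮q

i≤+∣i∣ : ∀ i → i ℤ.≤ + ∣ i ∣
i≤+∣i∣ (+ n)     = ℤP.≤-refl
i≤+∣i∣ ℤ.-[1+ n ] = ℤ.-≤+

module _ {n : ℕ} {a : ℕ → ℤ} (steps : ∀ m → suc m < n → a m - a (suc m) ℤ.≤ 1ℤ) where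

  a[p]-a[p+u]≤u : ∀ p u → p + u < n → a p - a (p + u) ℤ.≤ + u
  a[p]-a[p+u]≤u p zero _ rewrite +-identityʳ p = ℤP.≤-reflexive (ℤP.+-inverseʳ (a p))
  a[p]-a[p+u]≤u p (suc u) p+u<n rewrite +-suc p u = begin
    a p - a (suc p + u)                               ≡⟨ ℤP.+-minus-telescope (a p) (a (suc p)) _ ⟨
    (a p - a (suc p)) ℤ.+ (a (suc p) - a (suc p + u)) ≤⟨ ℤP.+-mono-≤ step (a[p]-a[p+u]≤u (suc p) u p+u<n) ⟩
    1ℤ ℤ.+ + u                                        ∎
    where
    open ℤP.≤-Reasoning
    step : a p - a (suc p) ℤ.≤ 1ℤ
    step = steps p (≤-<-trans (s≤s (m≤m+n p u)) p+u<n)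

  a[p]-a[q]≤q∸p : ∀ {p q} → p ≤ q → q < n → a p - a q ℤ.≤ + (q ∸ p)
  a[p]-a[q]≤q∸p {p} p≤q q<n with m≤n⇒∃[o]m+o≡n p≤q
  ... | u , refl rewrite m+n∸m≡n p u = a[p]-a[p+u]≤u p u q<n

m<[1+m/n]*n : ∀ m n .{{_ : NonZero n}} → m < suc (m / n) * n
m<[1+m/n]*n m n = begin-strict
  m                 ≡⟨ m≡m%n+[m/n]*n m n ⟩
  m % n + m / n * n <⟨ +-monoˡ-< (m / n * n) (m%n<n m n) ⟩
  n + m / n * n     ∎
  where open ≤-Reasoning

module _ {p i k : ℕ} (lca : LowestCommonAncestor p i k) where
  open LowestCommonAncestor lca

  span≤3*2^height : ∀ {d} → d + p ≡ suc i → suc d + (i ∸ k) ≤ 3 * 2 ^ height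
  span≤3*2^height {d} d+p≡1+i = begin
    suc d + u           ≤⟨ +-monoˡ-≤ u (s≤s d≤P+u) ⟩
    suc (P + u) + u     ≡⟨ cong suc (+-assoc P u u) ⟩
    suc (P + (u + u))   ≡⟨ +-suc P (u + u) ⟨
    P + (suc u + u)     ≤⟨ +-monoʳ-≤ P (+-mono-≤ u<P (<⇒≤ u<P)) ⟩
    P + (P + P)         ≡⟨ cong (λ z → P + (P + z)) (+-identityʳ P) ⟨
    3 * P               ∎
    where
    open ≤-Reasoning
    P u : ℕ
    P = 2 ^ height
    u = i ∸ k
    k+u≡i : k + u ≡ i
    k+u≡i = m+[n∸m]≡n k≤q
    u<P : u < P
    u<P = +-cancelˡ-< k u P (subst (_< k + P) (sym k+u≡i) q<k+2^height)
    d≤P+u : d ≤ P + u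
    d≤P+u = +-cancelˡ-≤ p d (P + u) (begin
      p + d        ≡⟨ trans (+-comm p d) d+p≡1+i ⟩
      suc i        ≡⟨ cong suc k+u≡i ⟨
      suc k + u    ≤⟨ +-monoˡ-≤ u k<p+2^height ⟩
      p + P + u    ≡⟨ +-assoc p P u ⟩
      p + (P + u)  ∎)

[+i-+d]+1≡1+i⊖d : ∀ i d → (+ i - + d) ℤ.+ 1ℤ ≡ suc i ℤ.⊖ d
[+i-+d]+1≡1+i⊖d i d = begin
  (+ i - + d) ℤ.+ 1ℤ   ≡⟨ ℤP.+-comm (+ i - + d) 1ℤ ⟩
  1ℤ ℤ.+ (+ i - + d)   ≡⟨ ℤP.+-assoc 1ℤ (+ i) (ℤ.- + d) ⟨
  + suc i - + d        ≡⟨ ℤP.[+m]-[+n]≡m⊖n (suc i) d ⟩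
  suc i ℤ.⊖ d          ∎
  where open ≡-Reasoning

[+i-+d]+1≡+[1+i∸d] : ∀ {i d} → d ≤ i → (+ i - + d) ℤ.+ 1ℤ ≡ + suc (i ∸ d)
[+i-+d]+1≡+[1+i∸d] {i} {d} d≤i =
  trans ([+i-+d]+1≡1+i⊖d i d) (trans (ℤP.⊖-≥ (m≤n⇒m≤1+n d≤i)) (cong +_ (+-∸-assoc 1 d≤i)))

[+i-+d]+1≤0 : ∀ {i d} → i < d → (+ i - + d) ℤ.+ 1ℤ ℤ.≤ 0ℤ
[+i-+d]+1≤0 {i} {d} i<d =
  subst (ℤ._≤ 0ℤ) (sym (trans ([+i-+d]+1≡1+i⊖d i d) (ℤP.⊖-≤ i<d))) ℤP.neg-≤-pos

module _ {n : ℕ} {a : ℕ → ℤ} (steps : ∀ m → suc m < n → a m - a (suc m) ℤ.≤ 1ℤ)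
         (b : ℕ) .{{_ : NonZero b}} {x : ℤ} where

  excess-at-ancestor : ∀ {p i k m} → LowestCommonAncestor p i k → m / b + p ≡ suc i → i * b < n
    → a (i * b) - x ≡ + m → a (k * b) - x ℤ.≤ + (fF n k * b)
  excess-at-ancestor {p} {i} {k} {m} lca d+p≡1+i ib<n excess = begin
    a (k * b) - x                                   ≡⟨ ℤP.+-minus-telescope (a (k * b)) (a (i * b)) x ⟨
    (a (k * b) - a (i * b)) ℤ.+ (a (i * b) - x)     ≤⟨ ℤP.+-mono-≤ descent (ℤP.≤-reflexive excess) ⟩
    + (i * b ∸ k * b + m)                           ≡⟨ cong +_ (trans (+-comm _ m) (cong (λ c → m + c) (sym (*-distribʳ-∸ b i k)))) ⟩
    + (m + (i ∸ k) * b)                             ≤⟨ ℤ.+≤+ (<⇒≤ bound) ⟩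
    + (3 * 2 ^ height * b)                          ≡⟨ cong (λ c → + (c * b)) (fF-2^j*odd n height offset node) ⟨
    + (fF n k * b)                                  ∎
    where
    open LowestCommonAncestor lca
    descent : a (k * b) - a (i * b) ℤ.≤ + (i * b ∸ k * b)
    descent = a[p]-a[q]≤q∸p {a = a} steps (*-monoˡ-≤ b k≤q) ib<n
    bound : m + (i ∸ k) * b < 3 * 2 ^ height * b
    bound = begin-strict
      m + (i ∸ k) * b               <⟨ +-monoˡ-< ((i ∸ k) * b) (m<[1+m/n]*n m b) ⟩
      suc (m / b) * b + (i ∸ k) * b ≡⟨ *-distribʳ-+ b (suc (m / b)) (i ∸ k) ⟨
      (suc (m / b) + (i ∸ k)) * b   ≤⟨ *-monoˡ-≤ b (span≤3*2^height lca d+p≡1+i) ⟩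
      3 * 2 ^ height * b            ∎
      where open ≤-Reasoning
    open ℤP.≤-Reasoning

  excess-at-lca : ∀ e i m → a 0 - x ℤ.< + n → i < 2 ^ e → i * b < n → a (i * b) - x ≡ + m
    → + fF n i ℤ.< + (m / b)
    → a (lcaBT e ((+ i - + (m / b)) ℤ.+ 1ℤ) (+ i) * b) - x
        ℤ.≤ + (fF n (lcaBT e ((+ i - + (m / b)) ℤ.+ 1ℤ) (+ i)) * b)
  excess-at-lca e zero m a₀-x<n _ _ excess n<d = contradiction
    (<-trans (ℤP.drop‿+<+ n<d) (≤-<-trans (m/n≤m m b) (ℤP.drop‿+<+ (subst (ℤ._< + n) excess a₀-x<n))))
    (<-irrefl refl)
  excess-at-lca e i@(suc _) m a₀-x<n i<2^e ib<n excess fi<d with m / b ≤? i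
  ... | yes d≤i rewrite [+i-+d]+1≡+[1+i∸d] d≤i =
    excess-at-ancestor (lcaBT-lowestCommonAncestor e z<s (∸-monoʳ-< 0<d d≤i) i<2^e)
      (trans (+-suc (m / b) (i ∸ m / b)) (cong suc (m+[n∸m]≡n d≤i))) ib<n excess
    where
    0<d : 0 < m / b
    0<d = ≤-<-trans z≤n (ℤP.drop‿+<+ fi<d)
  ... | no d≰i = subst (λ k → a (k * b) - x ℤ.≤ + (fF n k * b))
    (sym (lcaBT-nonpositive e ([+i-+d]+1≤0 (≰⇒> d≰i)) (ℤ.+<+ z<s)))
    (ℤP.≤-trans (ℤP.<⇒≤ a₀-x<n) (ℤ.+≤+ (m≤m*n n b)))

i-j<k⇒i-k<j : ∀ {i j k} → i - j ℤ.< k → i - k ℤ.< j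
i-j<k⇒i-k<j {i} {j} {k} i-j<k = begin-strict
  i - k                     ≡⟨ ℤP.+-minus-telescope i j k ⟨
  (i - j) ℤ.+ (j - k)       <⟨ ℤP.+-monoˡ-< (j - k) i-j<k ⟩
  k ℤ.+ (j - k)             ≡⟨ k+[j-k]≡j j k ⟩
  j                         ∎
  where
  open ℤP.≤-Reasoning
  k+[j-k]≡j : ∀ j k → k ℤ.+ (j - k) ≡ j
  k+[j-k]≡j = ℤSolver.solve-∀

claim3 : (n : ℕ) (a : ℕ → ℤ)
         → (∀ m → suc m ℕ.< n → ∣ a m - a (suc m) ∣ ≡ 1)
         → (b : ℕ) .{{_ : NonZero b}}
         → (e : ℕ) → (2 ^ e ∸ 1) ℕ.* b ℕ.< n
         → (i : ℕ) → i ℕ.≤ 2 ^ e ∸ 1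
         → (x : ℤ) → a 0 - + n ℤ.< x → x ℤ.< a (i ℕ.* b) - + (2 ℕ.* b)
         → let d = (a (i ℕ.* b) - x) /ℕ b
               l = (+ i - d) ℤ.+ 1ℤ
               k = lcaBT e l (+ i)
           in + fF n i ℤ.< d
           → a (k ℕ.* b) - x ℤ.≤ + (fF n k ℕ.* b)
claim3 n a unit-steps b e M-1<n i i≤M-1 x a₀-n<x x<aᵢ-2b with a (i * b) - x in excess
... | ℤ.-[1+ _ ] = contradiction
  (subst (0ℤ ℤ.≤_) excess (ℤP.i≤j⇒0≤j-i (ℤP.≤-trans (ℤP.<⇒≤ x<aᵢ-2b) (ℤP.i-j≤i (a (i * b)) (+ (2 * b)))))) λ ()
... | + m = excess-at-lca {a = a} steps b {x} e i m (i-j<k⇒i-k<j {a 0} a₀-n<x) i<M ib<n excess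
  where
  steps : ∀ m → suc m < n → a m - a (suc m) ℤ.≤ 1ℤ
  steps m m<n = ℤP.≤-trans (i≤+∣i∣ _) (ℤP.≤-reflexive (cong +_ (unit-steps m m<n)))
  i<M : i < 2 ^ e
  i<M = m≤pred[n]⇒suc[m]≤n {{m^n≢0 2 e}} i≤M-1
  ib<n : i * b < n
  ib<n = ≤-<-trans (*-monoˡ-≤ b i≤M-1) M-1<n
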